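{- Let $m \geq 3$ be odd, let $n \geq 4$ be even, and let $a,b\in\mathbb{Z}_n$ be such that the set $\pm\{a,b,a+b\}=\{\pm a,\pm b,\pm(a+b)\}$ has exactly $6$ elements. Then the Cayley graph $\mathrm{Cay}(\mathbb{Z}_m \times \mathbb{Z}_n, \{\pm 1\}\times(\pm\{a,b,a+b\}))$ admits a $C_m$-factorization consisting of six $C_m$-factors.
   Context: For a finite additive group $\Gamma$ and a subset $S\subseteq \Gamma\setminus\{0\}$ with $S=-S$, the Cayley graph $\mathrm{Cay}(\Gamma,S)$ has vertex set $\Gamma$ and edge set $\{\{x,y\}: x,y\in\Gamma,\ x-y\in S\}$. Here $\{\pm 1\}\times(\pm\{a,b,a+b\})=\{(\epsilon,c): \epsilon\in\{1,-1\},\ c\in\{\pm a,\pm b,\pm(a+b)\}\}\subseteq \mathbb{Z}_m\times\mathbb{Z}_n$. A $C_k$-factor of a graph is a spanning subgraph each of whose components is a cycle of length $k$; a $C_k$-factorization is a partition of the edge set into $C_k$-factors. -}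

module Defs where

open import Data.Nat using (ℕ; zero; suc; _+_; _∸_; NonZero)
open import Data.Nat.DivMod using (_mod_)
open import Data.Fin using (Fin; toℕ)
open import Data.Product using (Σ; _×_; _,_; proj₁; proj₂; ∃)
open import Data.Sum using (_⊎_)
open import Data.List using (List; []; _∷_)
open import Data.List.Membership.Propositional using (_∈_)
open import Relation.Binary.PropositionalEquality using (_≡_)
open import Function.Definitions using (Bijective)

module _ (n : ℕ) .{{_ : NonZero n}} where

  addℤ : Fin n → Fin n → Fin n
  addℤ x y = (toℕ x + toℕ y) mod n

  negℤ : Fin n → Fin n
  negℤ x = (n ∸ toℕ x) mod n

  subℤ : Fin n → Fin n → Fin n
  subℤ x y = addℤ x (negℤ y)

  oneℤ : Fin n
  oneℤ = 1 mod n

-- The list  a, -a, b, -b, a+b, -(a+b)  in ℤ_n; ±{a,b,a+b} is its set of entries.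
pmABAB : (n : ℕ) .{{_ : NonZero n}} → Fin n → Fin n → List (Fin n)
pmABAB n a b =
  a ∷ negℤ n a ∷ b ∷ negℤ n b ∷ addℤ n a b ∷ negℤ n (addℤ n a b) ∷ []

Vtx : ℕ → ℕ → Set
Vtx m n = Fin m × Fin n

InS : (m n : ℕ) .{{_ : NonZero m}} .{{_ : NonZero n}} →
      Fin n → Fin n → Fin m × Fin n → Set
InS m n a b (d₁ , d₂) = (d₁ ≡ oneℤ m ⊎ d₁ ≡ negℤ m (oneℤ m)) × (d₂ ∈ pmABAB n a b)

Adj : (m n : ℕ) .{{_ : NonZero m}} .{{_ : NonZero n}} →
      Fin n → Fin n → Vtx m n → Vtx m n → Set
Adj m n a b (x₁ , x₂) (y₁ , y₂) = InS m n a b (subℤ m x₁ y₁ , subℤ n x₂ y₂)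

-- A C_k-factor of a graph on vertex set V with adjacency E:
-- a family of c cycles, cycle i being the closed walk
--   cyc i 0, cyc i 1, ..., cyc i (k-1), cyc i 0,
-- such that (i , j) ↦ cyc i j is a bijection Fin c × Fin k → V
-- (the cycles are vertex-disjoint, each has k distinct vertices, and together
-- they span V), and consecutive vertices are adjacent in the graph.
record CFactor (k : ℕ) .{{_ : NonZero k}} (V : Set) (E : V → V → Set) : Set where
  field
    ncycles  : ℕ
    cyc      : Fin ncycles → Fin k → V
    spanning : Bijective _≡_ _≡_ (λ (p : Fin ncycles × Fin k) → cyc (proj₁ p) (proj₂ p))
    edges    : ∀ i j → E (cyc i j) (cyc i (addℤ k j (oneℤ k)))

InFactor : {k : ℕ} .{{_ : NonZero k}} {V : Set} {E : V → V → Set} →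
           CFactor k V E → V → V → Set
InFactor {k} F x y =
  Σ (Fin (CFactor.ncycles F)) λ i → Σ (Fin k) λ j →
    (CFactor.cyc F i j ≡ x × CFactor.cyc F i (addℤ k j (oneℤ k)) ≡ y) ⊎
    (CFactor.cyc F i j ≡ y × CFactor.cyc F i (addℤ k j (oneℤ k)) ≡ x)

record CFactorization (k t : ℕ) .{{_ : NonZero k}} (V : Set) (E : V → V → Set) : Set where
  field
    factor    : Fin t → CFactor k V E
    covers    : ∀ x y → E x y → Σ (Fin t) λ s → InFactor (factor s) x y
    disjoint  : ∀ x y → E x y → ∀ s s' →
                InFactor (factor s) x y → InFactor (factor s') x y → s ≡ s'

-- Index the six factors by the six connection differences. Factor s is the union
-- of the n closed walks j ↦ (j , c + w_s(j)) on ℤ_m × ℤ_n (c ∈ ℤ_n), where w_s is a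
-- walk in ℤ_n whose step from column j to column j + 1 is d_j(s). For every column j,
-- s ↦ d_j(s) is a bijection onto ±{a, b, a+b}, so every edge between columns j and
-- j + 1 lies in exactly one factor. The walks close after m steps: the first three
-- steps form a zero-sum triple (a, b, -(a+b)) or (-a, -b, a+b), cyclically rotated,
-- and the remaining m - 3 steps, an even number since m is odd, alternate d and -d.
module Submission where

open import Defs
open import Level using (0ℓ)
open import Algebra.Bundles using (AbelianGroup)
open import Algebra.Structures using (IsAbelianGroup)
open import Algebra.Definitions using (Associative; Commutative; LeftIdentity; LeftInverse)
open import Algebra.Consequences.Setoid using (comm∧idˡ⇒id; comm∧invˡ⇒inv)
import Algebra.Properties.AbelianGroup as AbelianGroupProperties
open import Data.Nat using (ℕ; zero; suc; _+_; _∸_; _%_; _≤_; z≤n; s≤s; NonZero; >-nonZero⁻¹)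
open import Data.Nat.Properties using (+-comm; +-assoc; m+[n∸m]≡n; <⇒≤; m≤n⇒m<n∨m≡n; ≤-trans)
open import Data.Nat.DivMod using (_mod_; m%n<n; %-distribˡ-+; m%n%n≡m%n; m<n⇒m%n≡m; n%n≡0)
open import Data.Nat.Divisibility using (_∣_; divides; ∣m∣n⇒∣m+n; n∣n)
open import Data.Fin using (Fin; zero; suc; toℕ; #_)
open import Data.Fin.Properties using (toℕ-injective; toℕ-fromℕ<; toℕ<n; all?; _≟_)
open import Data.Fin.Permutation as Permutation
  using (Permutation′; permutation; id; _∘ₚ_; _⟨$⟩ʳ_; _⟨$⟩ˡ_)
open import Data.Product using (_×_; _,_; proj₁; proj₂; ∃-syntax)
open import Data.Sum using (_⊎_; inj₁; inj₂)
import Data.Sum as Sum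
open import Data.Empty using (⊥; ⊥-elim)
open import Data.List using (List; length; lookup)
open import Data.List.Relation.Unary.Unique.Propositional using (Unique)
open import Data.List.Relation.Unary.AllPairs using (_∷_)
import Data.List.Relation.Unary.All as All
open import Data.List.Relation.Unary.Any using (index)
open import Data.List.Relation.Unary.Any.Properties using (lookup-index)
open import Data.List.Membership.Propositional using (_∈_)
open import Data.List.Membership.Propositional.Properties using (∈-lookup)
open import Data.Vec using (_∷_; [])
import Data.Vec as Vec
open import Function.Base using (_∘′_)
open import Function.Bundles using (Injection)
open import Function.Definitions using (Bijective)
open import Function.Properties.Inverse using (↔⇒↣)
open import Relation.Binary.PropositionalEquality as ≡
  using (_≡_; _≢_; refl; sym; trans; cong; module ≡-Reasoning)
open import Relation.Binary.PropositionalEquality.Algebra using (isMagma)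
open import Relation.Nullary using (¬_)
open import Relation.Nullary.Decidable using (from-yes)

module _ (n : ℕ) .{{_ : NonZero n}} where

  zeroℤ : Fin n
  zeroℤ = 0 mod n

  toℕ-mod : ∀ k → toℕ (k mod n) ≡ k % n
  toℕ-mod k = toℕ-fromℕ< (m%n<n k n)

  private
    toℕ-zeroℤ : toℕ zeroℤ ≡ 0
    toℕ-zeroℤ = trans (toℕ-mod 0) (m<n⇒m%n≡m (>-nonZero⁻¹ n))

    %-absorbˡ : ∀ k l → (k % n + l) % n ≡ (k + l) % n
    %-absorbˡ k l = begin
      (k % n + l) % n           ≡⟨ %-distribˡ-+ (k % n) l n ⟩
      (k % n % n + l % n) % n   ≡⟨ cong (λ t → (t + l % n) % n) (m%n%n≡m%n k n) ⟩
      (k % n + l % n) % n       ≡⟨ %-distribˡ-+ k l n ⟨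
      (k + l) % n               ∎
      where open ≡-Reasoning

    toℕ-addℤ² : ∀ x y z → toℕ (addℤ n (addℤ n x y) z) ≡ (toℕ x + toℕ y + toℕ z) % n
    toℕ-addℤ² x y z = trans (toℕ-mod _)
      (trans (cong (λ t → (t + toℕ z) % n) (toℕ-mod (toℕ x + toℕ y)))
             (%-absorbˡ (toℕ x + toℕ y) (toℕ z)))

  addℤ-comm : Commutative _≡_ (addℤ n)
  addℤ-comm x y = cong (_mod n) (+-comm (toℕ x) (toℕ y))

  addℤ-assoc : Associative _≡_ (addℤ n)
  addℤ-assoc x y z = toℕ-injective (begin
    toℕ (addℤ n (addℤ n x y) z)     ≡⟨ toℕ-addℤ² x y z ⟩
    (toℕ x + toℕ y + toℕ z) % n     ≡⟨ cong (_% n) (+-assoc (toℕ x) (toℕ y) (toℕ z)) ⟩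
    (toℕ x + (toℕ y + toℕ z)) % n   ≡⟨ cong (_% n) (+-comm (toℕ x) (toℕ y + toℕ z)) ⟩
    (toℕ y + toℕ z + toℕ x) % n     ≡⟨ toℕ-addℤ² y z x ⟨
    toℕ (addℤ n (addℤ n y z) x)     ≡⟨ cong toℕ (addℤ-comm (addℤ n y z) x) ⟩
    toℕ (addℤ n x (addℤ n y z))     ∎)
    where open ≡-Reasoning

  addℤ-identityˡ : LeftIdentity _≡_ zeroℤ (addℤ n)
  addℤ-identityˡ x = toℕ-injective (begin
    toℕ (addℤ n zeroℤ x)         ≡⟨ toℕ-mod _ ⟩
    (toℕ zeroℤ + toℕ x) % n      ≡⟨ cong (λ t → (t + toℕ x) % n) toℕ-zeroℤ ⟩
    toℕ x % n                    ≡⟨ m<n⇒m%n≡m (toℕ<n x) ⟩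
    toℕ x                        ∎)
    where open ≡-Reasoning

  negℤ-inverseˡ : LeftInverse _≡_ zeroℤ (negℤ n) (addℤ n)
  negℤ-inverseˡ x = toℕ-injective (begin
    toℕ (addℤ n (negℤ n x) x)              ≡⟨ toℕ-mod _ ⟩
    (toℕ (negℤ n x) + toℕ x) % n           ≡⟨ cong (λ t → (t + toℕ x) % n) (toℕ-mod (n ∸ toℕ x)) ⟩
    ((n ∸ toℕ x) % n + toℕ x) % n          ≡⟨ %-absorbˡ (n ∸ toℕ x) (toℕ x) ⟩
    (n ∸ toℕ x + toℕ x) % n                ≡⟨ cong (_% n) (+-comm (n ∸ toℕ x) (toℕ x)) ⟩
    (toℕ x + (n ∸ toℕ x)) % n              ≡⟨ cong (_% n) (m+[n∸m]≡n (<⇒≤ (toℕ<n x))) ⟩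
    n % n                                  ≡⟨ n%n≡0 n ⟩
    0                                      ≡⟨ toℕ-zeroℤ ⟨
    toℕ zeroℤ                              ∎)
    where open ≡-Reasoning

  addℤ-isAbelianGroup : IsAbelianGroup _≡_ (addℤ n) zeroℤ (negℤ n)
  addℤ-isAbelianGroup = record
    { isGroup = record
      { isMonoid = record
        { isSemigroup = record { isMagma = isMagma (addℤ n) ; assoc = addℤ-assoc }
        ; identity    = comm∧idˡ⇒id (≡.setoid (Fin n)) addℤ-comm addℤ-identityˡ
        }
      ; inverse = comm∧invˡ⇒inv (≡.setoid (Fin n)) addℤ-comm negℤ-inverseˡ
      ; ⁻¹-cong = cong (negℤ n)
      }
    ; comm = addℤ-comm
    }

  addℤ-abelianGroup : AbelianGroup 0ℓ 0ℓ
  addℤ-abelianGroup = record { isAbelianGroup = addℤ-isAbelianGroup }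

module _ {c ℓ} (G : AbelianGroup c ℓ) where
  open AbelianGroup G using (_≈_; _∙_; _⁻¹; _-_; setoid; ∙-congˡ; ∙-congʳ; ⁻¹-cong; comm)
  open AbelianGroupProperties G using (⁻¹-∙-comm; ⁻¹-anti-homo‿-; \\-leftDividesˡ; //-rightDividesˡ)
  open import Relation.Binary.Reasoning.Setoid setoid

  x-[x∙y]≈y⁻¹ : ∀ x y → x - (x ∙ y) ≈ y ⁻¹
  x-[x∙y]≈y⁻¹ x y = begin
    x ∙ (x ∙ y) ⁻¹     ≈⟨ ∙-congˡ (⁻¹-∙-comm x y) ⟨
    x ∙ (x ⁻¹ ∙ y ⁻¹)  ≈⟨ \\-leftDividesˡ x (y ⁻¹) ⟩
    y ⁻¹               ∎

  x-y≈z⇒x≈y∙z : ∀ {x y z} → x - y ≈ z → x ≈ y ∙ z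
  x-y≈z⇒x≈y∙z {x} {y} {z} x-y≈z = begin
    x            ≈⟨ //-rightDividesˡ y x ⟨
    (x - y) ∙ y  ≈⟨ ∙-congʳ x-y≈z ⟩
    z ∙ y        ≈⟨ comm z y ⟩
    y ∙ z        ∎

  x-y≈z⇒y≈x∙z⁻¹ : ∀ {x y z} → x - y ≈ z → y ≈ x ∙ z ⁻¹
  x-y≈z⇒y≈x∙z⁻¹ {x} {y} {z} x-y≈z = x-y≈z⇒x≈y∙z (begin
    y - x        ≈⟨ ⁻¹-anti-homo‿- x y ⟨
    (x - y) ⁻¹   ≈⟨ ⁻¹-cong x-y≈z ⟩
    z ⁻¹         ∎)

toℕ-oneℤ : ∀ m .{{_ : NonZero m}} → 2 ≤ m → toℕ (oneℤ m) ≡ 1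
toℕ-oneℤ _ (s≤s (s≤s _)) = refl

oneℤ+oneℤ≢zeroℤ : ∀ m .{{_ : NonZero m}} → 3 ≤ m → addℤ m (oneℤ m) (oneℤ m) ≢ zeroℤ m
oneℤ+oneℤ≢zeroℤ _ (s≤s (s≤s (s≤s _))) ()

lookup-injective : ∀ {A : Set} {xs : List A} → Unique xs → ∀ {i j} → lookup xs i ≡ lookup xs j → i ≡ j
lookup-injective (_ ∷ _)  {zero}  {zero}  _  = refl
lookup-injective (x∉ ∷ _) {zero}  {suc j} eq = ⊥-elim (All.lookup x∉ (∈-lookup j) eq)
lookup-injective (x∉ ∷ _) {suc i} {zero}  eq = ⊥-elim (All.lookup x∉ (∈-lookup i) (sym eq))
lookup-injective (_ ∷ u)  {suc i} {suc j} eq = cong suc (lookup-injective u eq)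

inFactor-sym : ∀ {k} .{{_ : NonZero k}} {V : Set} {E : V → V → Set} (F : CFactor k V E) {x y : V} →
               InFactor F x y → InFactor F y x
inFactor-sym F (i , j , p) = i , j , Sum.swap p

-- Adj m n a b is CayleyAdj m n (pmABAB n a b) by unfolding.
CayleyAdj : (m n : ℕ) .{{_ : NonZero m}} .{{_ : NonZero n}} → List (Fin n) → Vtx m n → Vtx m n → Set
CayleyAdj m n D (x₁ , x₂) (y₁ , y₂) =
  (subℤ m x₁ y₁ ≡ oneℤ m ⊎ subℤ m x₁ y₁ ≡ negℤ m (oneℤ m)) × subℤ n x₂ y₂ ∈ D

walk : ∀ {n} .{{_ : NonZero n}} (D : List (Fin n)) → (ℕ → Permutation′ (length D)) →
       Fin (length D) → ℕ → Fin n
walk {n} D σ s zero    = zeroℤ n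
walk {n} D σ s (suc j) = addℤ n (walk D σ s j) (lookup D (σ j ⟨$⟩ʳ s))

module CycleFactorization
  (m n : ℕ) .{{_ : NonZero m}} .{{_ : NonZero n}} (3≤m : 3 ≤ m)
  (D : List (Fin n)) (D-unique : Unique D) (D-neg : ∀ {d} → d ∈ D → negℤ n d ∈ D)
  (σ : ℕ → Permutation′ (length D)) (walk-closed : ∀ s → walk D σ s m ≡ zeroℤ n)
  where

  open AbelianGroup (addℤ-abelianGroup n) using (_∙_; _-_; assoc)
  open AbelianGroupProperties (addℤ-abelianGroup n) using (∙-cancelˡ; ∙-cancelʳ; //-rightDividesˡ)
  module ℤₘ = AbelianGroup (addℤ-abelianGroup m)
  open AbelianGroupProperties (addℤ-abelianGroup m) using (identityʳ-unique; ⁻¹-involutive)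

  Factor : Set
  Factor = Fin (length D)

  next : Fin m → Fin m
  next j = addℤ m j (oneℤ m)

  difference : Factor → ℕ → Fin n
  difference s j = lookup D (σ j ⟨$⟩ʳ s)

  position : Factor → Fin m → Fin n
  position s j = walk D σ s (toℕ j)

  walk-mod : ∀ s k → k ≤ m → walk D σ s (k % m) ≡ walk D σ s k
  walk-mod s k k≤m with m≤n⇒m<n∨m≡n k≤m
  ... | inj₁ k<m = cong (walk D σ s) (m<n⇒m%n≡m k<m)
  ... | inj₂ refl = trans (cong (walk D σ s) (n%n≡0 m)) (sym (walk-closed s))

  position-next : ∀ s j → position s (next j) ≡ position s j ∙ difference s (toℕ j)
  position-next s j = begin
    walk D σ s (toℕ (next j))       ≡⟨ cong (walk D σ s) toℕ-next ⟩
    walk D σ s (suc (toℕ j) % m)    ≡⟨ walk-mod s (suc (toℕ j)) (toℕ<n j) ⟩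
    walk D σ s (suc (toℕ j))        ∎
    where
    open ≡-Reasoning
    2≤m : 2 ≤ m
    2≤m = ≤-trans (s≤s (s≤s z≤n)) 3≤m
    toℕ-next : toℕ (next j) ≡ suc (toℕ j) % m
    toℕ-next = begin
      toℕ (next j)                   ≡⟨ toℕ-mod m _ ⟩
      (toℕ j + toℕ (oneℤ m)) % m     ≡⟨ cong (λ t → (toℕ j + t) % m) (toℕ-oneℤ m 2≤m) ⟩
      (toℕ j + 1) % m                ≡⟨ cong (_% m) (+-comm (toℕ j) 1) ⟩
      suc (toℕ j) % m                ∎

  cycle : Factor → Fin n → Fin m → Vtx m n
  cycle s c j = j , c ∙ position s j

  Arc : Vtx m n → Vtx m n → Set
  Arc (u₁ , u₂) (v₁ , v₂) = v₁ ≡ next u₁ × ∃[ d ] d ∈ D × v₂ ≡ u₂ ∙ d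

  Traverses : Factor → Vtx m n → Vtx m n → Set
  Traverses s (u₁ , u₂) (v₁ , v₂) = v₁ ≡ next u₁ × v₂ ≡ u₂ ∙ difference s (toℕ u₁)

  arc⇒adj : ∀ {u v} → Arc u v → CayleyAdj m n D u v
  arc⇒adj {u₁ , u₂} (refl , d , d∈D , refl) =
    inj₂ (x-[x∙y]≈y⁻¹ (addℤ-abelianGroup m) u₁ (oneℤ m)) ,
    ≡.subst (_∈ D) (sym (x-[x∙y]≈y⁻¹ (addℤ-abelianGroup n) u₂ d)) (D-neg d∈D)

  adj⇒arc : ∀ {u v} → CayleyAdj m n D u v → Arc u v ⊎ Arc v u
  adj⇒arc (inj₁ u₁-v₁≡1 , u₂-v₂∈D) =
    inj₂ ( x-y≈z⇒x≈y∙z (addℤ-abelianGroup m) u₁-v₁≡1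
         , _ , u₂-v₂∈D , x-y≈z⇒x≈y∙z (addℤ-abelianGroup n) refl)
  adj⇒arc (inj₂ u₁-v₁≡-1 , u₂-v₂∈D) =
    inj₁ ( trans (x-y≈z⇒y≈x∙z⁻¹ (addℤ-abelianGroup m) u₁-v₁≡-1)
                 (cong (addℤ m _) (⁻¹-involutive (oneℤ m)))
         , _ , D-neg u₂-v₂∈D , x-y≈z⇒y≈x∙z⁻¹ (addℤ-abelianGroup n) refl)

  arc-asym : ∀ {u v} → Arc u v → Arc v u → ⊥
  arc-asym {u₁ , _} (refl , _) (u₁≡u₁+1+1 , _) = oneℤ+oneℤ≢zeroℤ m 3≤m
    (identityʳ-unique u₁ _ (sym (trans u₁≡u₁+1+1 (ℤₘ.assoc u₁ (oneℤ m) (oneℤ m)))))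

  traverses⇒arc : ∀ {s u v} → Traverses s u v → Arc u v
  traverses⇒arc (p , q) = p , _ , ∈-lookup _ , q

  arc⇒traverses : ∀ {u v} → Arc u v → ∃[ s ] Traverses s u v
  arc⇒traverses {u₁ , u₂} {_ , v₂} (p , d , d∈D , q) = s , p , (begin
    v₂                           ≡⟨ q ⟩
    u₂ ∙ d                       ≡⟨ cong (u₂ ∙_) (lookup-index d∈D) ⟩
    u₂ ∙ lookup D (index d∈D)    ≡⟨ cong (λ i → u₂ ∙ lookup D i) (Permutation.inverseʳ (σ (toℕ u₁))) ⟨
    u₂ ∙ difference s (toℕ u₁)   ∎)
    where
    open ≡-Reasoning
    s : Factor
    s = σ (toℕ u₁) ⟨$⟩ˡ index d∈D

  traverses-injective : ∀ {s s' u v} → Traverses s u v → Traverses s' u v → s ≡ s'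
  traverses-injective {u = u₁ , u₂} (_ , q) (_ , q') =
    Injection.injective (↔⇒↣ (σ (toℕ u₁)))
      (lookup-injective D-unique (∙-cancelˡ u₂ _ _ (trans (sym q) q')))

  cycle-traverses : ∀ s c j → Traverses s (cycle s c j) (cycle s c (next j))
  cycle-traverses s c j = refl , trans (cong (c ∙_) (position-next s j)) (sym (assoc c _ _))

  traverses⇒cycle : ∀ {s u v} → Traverses s u v →
                    ∃[ c ] cycle s c (proj₁ u) ≡ u × cycle s c (next (proj₁ u)) ≡ v
  traverses⇒cycle {s} {u₁ , u₂} (refl , refl) = c , cong (u₁ ,_) c∙p≡u₂ , cong (next u₁ ,_) (begin
    c ∙ position s (next u₁)                   ≡⟨ proj₂ (cycle-traverses s c u₁) ⟩
    c ∙ position s u₁ ∙ difference s (toℕ u₁)  ≡⟨ cong (_∙ difference s (toℕ u₁)) c∙p≡u₂ ⟩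
    u₂ ∙ difference s (toℕ u₁)                 ∎)
    where
    open ≡-Reasoning
    c : Fin n
    c = u₂ - position s u₁
    c∙p≡u₂ : c ∙ position s u₁ ≡ u₂
    c∙p≡u₂ = //-rightDividesˡ (position s u₁) u₂

  cycle-bijective : ∀ s → Bijective _≡_ _≡_ (λ (p : Fin n × Fin m) → cycle s (proj₁ p) (proj₂ p))
  cycle-bijective s = injective , surjective
    where
    injective : ∀ {p q} → cycle s (proj₁ p) (proj₂ p) ≡ cycle s (proj₁ q) (proj₂ q) → p ≡ q
    injective {c , j} eq with refl ← cong proj₁ eq =
      cong (_, j) (∙-cancelʳ (position s j) c _ (cong proj₂ eq))
    surjective : ∀ v → ∃[ p ] ∀ {q} → q ≡ p → cycle s (proj₁ q) (proj₂ q) ≡ v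
    surjective (v₁ , v₂) =
      (v₂ - position s v₁ , v₁) , λ { refl → cong (v₁ ,_) (//-rightDividesˡ (position s v₁) v₂) }

  factor : Factor → CFactor m (Vtx m n) (CayleyAdj m n D)
  factor s = record
    { ncycles  = n
    ; cyc      = cycle s
    ; spanning = cycle-bijective s
    ; edges    = λ c j → arc⇒adj (traverses⇒arc (cycle-traverses s c j))
    }

  traverses⇒inFactor : ∀ {s u v} → Traverses s u v → InFactor (factor s) u v
  traverses⇒inFactor {u = u₁ , _} t with c , p , q ← traverses⇒cycle t = c , u₁ , inj₁ (p , q)

  inFactor⇒traverses : ∀ {s u v} → InFactor (factor s) u v → Traverses s u v ⊎ Traverses s v u
  inFactor⇒traverses {s} (c , j , inj₁ (refl , refl)) = inj₁ (cycle-traverses s c j)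
  inFactor⇒traverses {s} (c , j , inj₂ (refl , refl)) = inj₂ (cycle-traverses s c j)

  factorization : CFactorization m (length D) (Vtx m n) (CayleyAdj m n D)
  factorization = record { factor = factor ; covers = covers ; disjoint = disjoint }
    where
    covers : ∀ u v → CayleyAdj m n D u v → ∃[ s ] InFactor (factor s) u v
    covers u v adj with adj⇒arc adj
    ... | inj₁ arc with s , t ← arc⇒traverses arc = s , traverses⇒inFactor t
    ... | inj₂ arc with s , t ← arc⇒traverses arc = s , inFactor-sym (factor s) (traverses⇒inFactor t)

    disjoint : ∀ u v → CayleyAdj m n D u v → ∀ s s' →
               InFactor (factor s) u v → InFactor (factor s') u v → s ≡ s'
    disjoint u v _ s s' h h' with inFactor⇒traverses h | inFactor⇒traverses h'
    ... | inj₁ t | inj₁ t' = traverses-injective t t'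
    ... | inj₂ t | inj₂ t' = traverses-injective t t'
    ... | inj₁ t | inj₂ t' = ⊥-elim (arc-asym (traverses⇒arc t) (traverses⇒arc t'))
    ... | inj₂ t | inj₁ t' = ⊥-elim (arc-asym (traverses⇒arc t) (traverses⇒arc t'))

-- Indices 0 … 5 of pmABAB n a b hold a, -a, b, -b, a+b, -(a+b). pmABAB-negation swaps
-- each element with its negative; pmABAB-successor cycles a → b → -(a+b) → a and
-- -a → -b → a+b → -a, the two zero-sum triples.
pmABAB-negation : Permutation′ 6
pmABAB-negation = permutation ν ν ν-involutive ν-involutive
  where
  ν : Fin 6 → Fin 6
  ν = Vec.lookup (# 1 ∷ # 0 ∷ # 3 ∷ # 2 ∷ # 5 ∷ # 4 ∷ [])
  ν-involutive : ∀ i → ν (ν i) ≡ i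
  ν-involutive = from-yes (all? λ i → ν (ν i) ≟ i)

pmABAB-successor : Permutation′ 6
pmABAB-successor = permutation σ σ⁻¹ σ∘σ⁻¹ σ⁻¹∘σ
  where
  σ σ⁻¹ : Fin 6 → Fin 6
  σ   = Vec.lookup (# 2 ∷ # 3 ∷ # 5 ∷ # 4 ∷ # 1 ∷ # 0 ∷ [])
  σ⁻¹ = Vec.lookup (# 5 ∷ # 4 ∷ # 0 ∷ # 1 ∷ # 3 ∷ # 2 ∷ [])
  σ∘σ⁻¹ : ∀ i → σ (σ⁻¹ i) ≡ i
  σ∘σ⁻¹ = from-yes (all? λ i → σ (σ⁻¹ i) ≟ i)
  σ⁻¹∘σ : ∀ i → σ⁻¹ (σ i) ≡ i
  σ⁻¹∘σ = from-yes (all? λ i → σ⁻¹ (σ i) ≟ i)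

pmABAB-alternating : ℕ → Permutation′ 6
pmABAB-alternating zero          = id
pmABAB-alternating (suc zero)    = pmABAB-negation
pmABAB-alternating (suc (suc k)) = pmABAB-alternating k

pmABAB-step : ℕ → Permutation′ 6
pmABAB-step 0                   = id
pmABAB-step 1                   = pmABAB-successor
pmABAB-step 2                   = pmABAB-successor ∘ₚ pmABAB-successor
pmABAB-step (suc (suc (suc k))) = pmABAB-alternating k

module _ (n : ℕ) .{{_ : NonZero n}} (a b : Fin n) where
  open AbelianGroup (addℤ-abelianGroup n)
    using (_∙_; ε; _⁻¹; assoc; comm; identityˡ; identityʳ; inverseˡ; inverseʳ)
  open AbelianGroupProperties (addℤ-abelianGroup n) using (⁻¹-involutive; ⁻¹-∙-comm)

  el : Fin 6 → Fin n
  el = lookup (pmABAB n a b)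

  el-negation : ∀ i → el (pmABAB-negation ⟨$⟩ʳ i) ≡ el i ⁻¹
  el-negation zero                                = refl
  el-negation (suc zero)                          = sym (⁻¹-involutive a)
  el-negation (suc (suc zero))                    = refl
  el-negation (suc (suc (suc zero)))              = sym (⁻¹-involutive b)
  el-negation (suc (suc (suc (suc zero))))        = refl
  el-negation (suc (suc (suc (suc (suc zero))))) = sym (⁻¹-involutive (a ∙ b))

  pmABAB-neg : ∀ {d} → d ∈ pmABAB n a b → negℤ n d ∈ pmABAB n a b
  pmABAB-neg {d} d∈D =
    ≡.subst (_∈ pmABAB n a b) el[ν[i]]≡-d (∈-lookup (pmABAB-negation ⟨$⟩ʳ index d∈D))
    where
    el[ν[i]]≡-d : el (pmABAB-negation ⟨$⟩ʳ index d∈D) ≡ negℤ n d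
    el[ν[i]]≡-d = trans (el-negation (index d∈D)) (cong _⁻¹ (sym (lookup-index d∈D)))

  ZeroSum : Fin n → Fin n → Fin n → Set
  ZeroSum x y z = x ∙ y ∙ z ≡ ε

  zeroSum-rotate : ∀ {x y z} → ZeroSum x y z → ZeroSum y z x
  zeroSum-rotate {x} {y} {z} xyz = trans (comm (y ∙ z) x) (trans (sym (assoc x y z)) xyz)

  zeroSum⁺ : ZeroSum a b ((a ∙ b) ⁻¹)
  zeroSum⁺ = inverseʳ (a ∙ b)

  zeroSum⁻ : ZeroSum (a ⁻¹) (b ⁻¹) (a ∙ b)
  zeroSum⁻ = trans (cong (_∙ (a ∙ b)) (⁻¹-∙-comm a b)) (inverseˡ (a ∙ b))

  el-successor-zeroSum : ∀ i → let succ = pmABAB-successor ⟨$⟩ʳ_ in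
                         ZeroSum (el i) (el (succ i)) (el (succ (succ i)))
  el-successor-zeroSum zero                                = zeroSum⁺
  el-successor-zeroSum (suc zero)                          = zeroSum⁻
  el-successor-zeroSum (suc (suc zero))                    = zeroSum-rotate zeroSum⁺
  el-successor-zeroSum (suc (suc (suc zero)))              = zeroSum-rotate zeroSum⁻
  el-successor-zeroSum (suc (suc (suc (suc zero))))        = zeroSum-rotate (zeroSum-rotate zeroSum⁻)
  el-successor-zeroSum (suc (suc (suc (suc (suc zero))))) = zeroSum-rotate (zeroSum-rotate zeroSum⁺)

  el-alternating-cancel : ∀ k i →
    el (pmABAB-alternating k ⟨$⟩ʳ i) ∙ el (pmABAB-alternating (suc k) ⟨$⟩ʳ i) ≡ ε
  el-alternating-cancel zero          i = trans (cong (el i ∙_) (el-negation i)) (inverseʳ (el i))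
  el-alternating-cancel (suc zero)    i = trans (cong (_∙ el i) (el-negation i)) (inverseˡ (el i))
  el-alternating-cancel (suc (suc k))   = el-alternating-cancel k

  pmABAB-walk-closed : ∀ k → ¬ 2 ∣ (3 + k) → ∀ i → walk (pmABAB n a b) pmABAB-step i (3 + k) ≡ ε
  pmABAB-walk-closed zero _ i =
    trans (cong (λ x → x ∙ el (succ i) ∙ el (succ (succ i))) (identityˡ (el i))) (el-successor-zeroSum i)
    where
    succ : Fin 6 → Fin 6
    succ = pmABAB-successor ⟨$⟩ʳ_
  pmABAB-walk-closed (suc zero) odd _ = ⊥-elim (odd (divides 2 refl))
  pmABAB-walk-closed (suc (suc k)) odd i = begin
    w ∙ d ∙ d'    ≡⟨ assoc w d d' ⟩
    w ∙ (d ∙ d')  ≡⟨ cong (w ∙_) (el-alternating-cancel k i) ⟩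
    w ∙ ε         ≡⟨ identityʳ w ⟩
    w             ≡⟨ pmABAB-walk-closed k (odd ∘′ ∣m∣n⇒∣m+n n∣n) i ⟩
    ε             ∎
    where
    open ≡-Reasoning
    w d d' : Fin n
    w  = walk (pmABAB n a b) pmABAB-step i (3 + k)
    d  = el (pmABAB-alternating k ⟨$⟩ʳ i)
    d' = el (pmABAB-alternating (suc k) ⟨$⟩ʳ i)

lemma2p8 : (m n : ℕ) .{{_ : NonZero m}} .{{_ : NonZero n}} →
           3 ≤ m → ¬ (2 ∣ m) → 4 ≤ n → 2 ∣ n →
           (a b : Fin n) → Unique (pmABAB n a b) →
           CFactorization m 6 (Vtx m n) (Adj m n a b)
lemma2p8 m@(suc (suc (suc k))) n 3≤m@(s≤s (s≤s (s≤s _))) m-odd _ _ a b unique =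
  CycleFactorization.factorization m n 3≤m (pmABAB n a b) unique (pmABAB-neg n a b) pmABAB-step
    (pmABAB-walk-closed n a b k m-odd)
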